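{- Let $m\geq 2$ be an integer, $G$ a finite group, and $\Gamma=\mathrm{Cay}(G,(T_{i,j})_{m\times m})$ an $m$-Cayley graph of $G$ such that $\langle T_{i,j}\mid i,j\in\{1,\dots,m\}\rangle=G$. Let $A=\mathrm{Aut}(\Gamma)$. Suppose that $A$ stabilizes $G_1$ (setwise) and that, for each $i\in\{1,\dots,m\}$, $A_{1_1}=A_{1_i}$ and $A_{1_i}$ fixes the neighbourhood $\Gamma(1_i)$ pointwise. Then $A=R_m(G)$, i.e. $A$ equals the copy of $G$ acting by right multiplication.
   Context: For a finite group $G$ and integer $m\geq1$, let $(T_{i,j})_{m\times m}$ be a matrix of subsets of $G$ with $1\notin T_{i,i}$ and $T_{j,i}=T_{i,j}^{ -1}$ for all $i,j$. The $m$-Cayley graph $\mathrm{Cay}(G,(T_{i,j})_{m\times m})$ has vertex set $G\times\{1,\dots,m\}$ (write $g_i=(g,i)$, $G_i=G\times\{i\}$, and $1$ for the identity of $G$) and edges $\{g_i,(tg)_j\}$ for all $i,j$, $g\in G$, $t\in T_{i,j}$. For $g\in G$, $R_m(g)$ is the automorphism $x_i\mapsto (xg)_i$, and $R_m(G)=\{R_m(g):g\in G\}\cong G$. $A_v$ denotes the stabilizer in $A$ of the vertex $v$, and $\Gamma(v)$ the set of neighbours of $v$. -}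

module Defs where

open import Level using (0ℓ)
open import Data.Nat using (ℕ)
open import Data.Fin using (Fin)
open import Data.Product using (Σ; ∃; ∃-syntax; _×_; _,_; proj₁; proj₂)
open import Relation.Binary.PropositionalEquality using (_≡_)
open import Algebra.Structures using (IsGroup)
open import Function.Bundles using (_↔_; Inverse; _⇔_)

record FiniteGroup : Set₁ where
  field
    Carrier : Set
    _∙_     : Carrier → Carrier → Carrier
    ε       : Carrier
    _⁻¹     : Carrier → Carrier
    isGroup : IsGroup _≡_ _∙_ ε _⁻¹
    size    : ℕ
    enum    : Carrier ↔ Fin size

module _ (G : FiniteGroup) where
  open FiniteGroup G

  data Generated (S : Carrier → Set) : Carrier → Set where
    gen : ∀ {x} → S x → Generated S x
    one : Generated S ε
    mul : ∀ {x y} → Generated S x → Generated S y → Generated S (x ∙ y)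
    inv : ∀ {x} → Generated S x → Generated S (x ⁻¹)

module Cayley (G : FiniteGroup) (m : ℕ) (T : Fin m → Fin m → FiniteGroup.Carrier G → Set) where
  open FiniteGroup G

  Vertex : Set
  Vertex = Carrier × Fin m

  Adj : Vertex → Vertex → Set
  Adj (g , i) (h , j) = ∃[ t ] (T i j t × h ≡ t ∙ g)

  IsAut : (Vertex ↔ Vertex) → Set
  IsAut σ = ∀ u v → Adj u v ⇔ Adj (Inverse.to σ u) (Inverse.to σ v)

  Rm : Carrier → Vertex → Vertex
  Rm g (x , i) = (x ∙ g , i)

{-# OPTIONS --safe #-}
module Submission where

-- Composing an automorphism σ with σ(1_1) ∈ G_1 with a right translation gives an automorphism τ
-- fixing 1_1. The set of x whose fibre {x_i} is fixed pointwise by τ contains t x whenever it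
-- contains x and t ∈ T i j; as the T i j are closed under inversion and generate G, it is all of
-- G, so τ = 1 and σ ∈ R_m(G).

open import Defs
open import Level using (0ℓ)
open import Data.Nat using (ℕ; suc; _≤_)
open import Data.Fin using (Fin; zero)
open import Data.Product using (Σ; ∃; ∃-syntax; _×_; _,_; proj₁; proj₂)
open import Relation.Binary.PropositionalEquality
  using (_≡_; refl; sym; trans; cong; subst; module ≡-Reasoning)
open import Relation.Nullary using (¬_)
open import Function.Bundles using (_↔_; Inverse; _⇔_; mk↔ₛ′; mk⇔; Equivalence)
open import Function.Base using (_∘_)
open import Function.Construct.Composition using (_↔-∘_; _⇔-∘_)
open import Function.Construct.Symmetry using (⇔-sym)
open import Function.Related.Propositional using (equivalence; module EquationalReasoning)
open import Algebra.Bundles using (Group)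
open import Algebra.Structures using (IsGroup)
import Algebra.Properties.Group as GroupProperties

module FiniteGroupProperties (G : FiniteGroup) where
  open FiniteGroup G

  group : Group 0ℓ 0ℓ
  group = record { isGroup = isGroup }

  open IsGroup isGroup public using (assoc; identityˡ; identityʳ; inverseʳ)
  open GroupProperties group public
    using (\\-leftDividesˡ; \\-leftDividesʳ; //-rightDividesˡ; //-rightDividesʳ; ∙-cancelʳ)

  LeftInvariantUnder : (Carrier → Set) → Carrier → Set
  LeftInvariantUnder P g = ∀ x → P x ⇔ P (g ∙ x)

  open EquationalReasoning {k = equivalence}

  generated⇒leftInvariant : ∀ (P : Carrier → Set) {S : Carrier → Set} →
    (∀ {s} → S s → LeftInvariantUnder P s) →
    ∀ {g} → Generated G S g → LeftInvariantUnder P g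
  generated⇒leftInvariant P S-invariant (gen s) = S-invariant s
  generated⇒leftInvariant P S-invariant one x = begin
    P x        ≡⟨ cong P (sym (identityˡ x)) ⟩
    P (ε ∙ x)  ∎
  generated⇒leftInvariant P S-invariant (mul {g} {h} Sg Sh) x = begin
    P x              ∼⟨ generated⇒leftInvariant P S-invariant Sh x ⟩
    P (h ∙ x)        ∼⟨ generated⇒leftInvariant P S-invariant Sg (h ∙ x) ⟩
    P (g ∙ (h ∙ x))  ≡⟨ cong P (sym (assoc g h x)) ⟩
    P ((g ∙ h) ∙ x)  ∎
  generated⇒leftInvariant P S-invariant (inv {g} Sg) x = begin
    P x                   ≡⟨ cong P (sym (\\-leftDividesˡ g x)) ⟩
    P (g ∙ ((g ⁻¹) ∙ x))  ∼⟨ ⇔-sym (generated⇒leftInvariant P S-invariant Sg ((g ⁻¹) ∙ x)) ⟩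
    P ((g ⁻¹) ∙ x)        ∎

module CayleyAutomorphisms
  (G : FiniteGroup) (m : ℕ) (T : Fin m → Fin m → FiniteGroup.Carrier G → Set) where
  open FiniteGroup G
  open FiniteGroupProperties G
  open Cayley G m T
  open Inverse using (to)

  Fixes : Vertex ↔ Vertex → Vertex → Set
  Fixes σ v = to σ v ≡ v

  Rm-inverseˡ : ∀ g v → Rm g (Rm (g ⁻¹) v) ≡ v
  Rm-inverseˡ g (x , i) = cong (_, i) (//-rightDividesˡ g x)

  Rm-inverseʳ : ∀ g v → Rm (g ⁻¹) (Rm g v) ≡ v
  Rm-inverseʳ g (x , i) = cong (_, i) (//-rightDividesʳ g x)

  Rm↔ : Carrier → Vertex ↔ Vertex
  Rm↔ g = mk↔ₛ′ (Rm g) (Rm (g ⁻¹)) (Rm-inverseˡ g) (Rm-inverseʳ g)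

  Rm-isAut : ∀ g → IsAut (Rm↔ g)
  Rm-isAut g (x , i) (y , j) = mk⇔
    (λ { (t , t∈T , y≡tx) → t , t∈T , trans (cong (_∙ g) y≡tx) (assoc t x g) })
    (λ { (t , t∈T , yg≡txg) →
           t , t∈T , ∙-cancelʳ g y (t ∙ x) (trans yg≡txg (sym (assoc t x g))) })

  ↔-∘-isAut : ∀ σ τ → IsAut σ → IsAut τ → IsAut (σ ↔-∘ τ)
  ↔-∘-isAut σ τ σ-aut τ-aut u v = σ-aut (to τ u) (to τ v) ⇔-∘ τ-aut u v

  Rm-conj : Carrier → Vertex ↔ Vertex → Vertex ↔ Vertex
  Rm-conj x σ = Rm↔ (x ⁻¹) ↔-∘ (σ ↔-∘ Rm↔ x)

  Rm-conj-isAut : ∀ x σ → IsAut σ → IsAut (Rm-conj x σ)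
  Rm-conj-isAut x σ σ-aut =
    ↔-∘-isAut (Rm↔ (x ⁻¹)) (σ ↔-∘ Rm↔ x) (Rm-isAut (x ⁻¹))
      (↔-∘-isAut σ (Rm↔ x) σ-aut (Rm-isAut x))

  -- Since R_m(G) is transitive on each G_i, conjugating by it transports hypotheses about the
  -- stabiliser of 1_i to the stabiliser of any x_i.
  fixes-Rm-conj : ∀ x σ v → Fixes (Rm-conj x σ) v ⇔ Fixes σ (Rm x v)
  fixes-Rm-conj x σ v = mk⇔
    (λ fix → trans (sym (Rm-inverseˡ x (to σ (Rm x v)))) (cong (Rm x) fix))
    (λ fix → trans (cong (Rm (x ⁻¹)) fix) (Rm-inverseʳ x v))

  fixes-Rm-conj-identity : ∀ x σ i → Fixes (Rm-conj x σ) (ε , i) ⇔ Fixes σ (x , i)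
  fixes-Rm-conj-identity x σ i =
    subst (λ y → Fixes (Rm-conj x σ) (ε , i) ⇔ Fixes σ (y , i)) (identityˡ x)
      (fixes-Rm-conj x σ (ε , i))

  FixesFibre : Vertex ↔ Vertex → Carrier → Set
  FixesFibre σ x = ∀ i → Fixes σ (x , i)

  Connection : Carrier → Set
  Connection t = ∃[ i ] ∃[ j ] T i j t

  StabilisersOfIdentityCoincide : Set
  StabilisersOfIdentityCoincide = ∀ σ → IsAut σ → ∀ i j → Fixes σ (ε , i) → Fixes σ (ε , j)

  StabilisersFixNeighbourhoods : Set
  StabilisersFixNeighbourhoods =
    ∀ σ → IsAut σ → ∀ i → Fixes σ (ε , i) → ∀ v → Adj (ε , i) v → Fixes σ v

  module Rigidity (stab-ε : StabilisersOfIdentityCoincide)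
                  (stab-Γ : StabilisersFixNeighbourhoods) where

    fixes⇒fixesFibre : ∀ σ → IsAut σ → ∀ {x i} → Fixes σ (x , i) → FixesFibre σ x
    fixes⇒fixesFibre σ σ-aut {x} {i} fix j =
      Equivalence.to (fixes-Rm-conj-identity x σ j)
        (stab-ε (Rm-conj x σ) (Rm-conj-isAut x σ σ-aut) i j
          (Equivalence.from (fixes-Rm-conj-identity x σ i) fix))

    fixes-neighbour : ∀ σ → IsAut σ → ∀ {x i j t} → T i j t →
      Fixes σ (x , i) → Fixes σ (t ∙ x , j)
    fixes-neighbour σ σ-aut {x} {i} {j} {t} t∈T fix =
      subst (λ y → Fixes σ (y , j)) (cong (_∙ x) (identityʳ t))
        (Equivalence.to (fixes-Rm-conj x σ (t ∙ ε , j))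
          (stab-Γ (Rm-conj x σ) (Rm-conj-isAut x σ σ-aut) i
            (Equivalence.from (fixes-Rm-conj-identity x σ i) fix)
            (t ∙ ε , j) (t , t∈T , refl)))

    fixesFibre-step : ∀ σ → IsAut σ → ∀ {x i j t} → T i j t →
      FixesFibre σ x → FixesFibre σ (t ∙ x)
    fixesFibre-step σ σ-aut t∈T fix =
      fixes⇒fixesFibre σ σ-aut (fixes-neighbour σ σ-aut t∈T (fix _))

    module Connected (T-symmetric : ∀ i j t → T i j t → T j i (t ⁻¹))
                     (generates : ∀ g → Generated G Connection g) where

      fixesFibre-leftInvariant : ∀ σ → IsAut σ → ∀ {t} → Connection t →
        LeftInvariantUnder (FixesFibre σ) t
      fixesFibre-leftInvariant σ σ-aut {t} (i , j , t∈T) x = mk⇔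
        (fixesFibre-step σ σ-aut t∈T)
        (λ fix → subst (FixesFibre σ) (\\-leftDividesʳ t x)
                   (fixesFibre-step σ σ-aut (T-symmetric i j t t∈T) fix))

      fixes⇒identity : ∀ σ → IsAut σ → ∀ {i} → Fixes σ (ε , i) → ∀ v → Fixes σ v
      fixes⇒identity σ σ-aut fix (x , j) =
        subst (λ y → Fixes σ (y , j)) (identityʳ x)
          (Equivalence.to
            (generated⇒leftInvariant (FixesFibre σ) (fixesFibre-leftInvariant σ σ-aut)
              (generates x) ε)
            (fixes⇒fixesFibre σ σ-aut fix) j)

      layerPreserving⇒Rm : ∀ σ → IsAut σ → ∀ {i} → proj₂ (to σ (ε , i)) ≡ i →
        ∃[ g ] (∀ v → to σ v ≡ Rm g v)
      layerPreserving⇒Rm σ σ-aut {i} layer = h , λ v → begin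
          to σ v          ≡⟨ sym (Rm-inverseˡ h (to σ v)) ⟩
          Rm h (to τ v)   ≡⟨ cong (Rm h) (fixes⇒identity τ τ-aut τ-fixes v) ⟩
          Rm h v          ∎
        where
        open ≡-Reasoning
        h : Carrier
        h = proj₁ (to σ (ε , i))
        τ : Vertex ↔ Vertex
        τ = Rm↔ (h ⁻¹) ↔-∘ σ
        τ-aut : IsAut τ
        τ-aut = ↔-∘-isAut (Rm↔ (h ⁻¹)) σ (Rm-isAut (h ⁻¹)) σ-aut
        τ-fixes : Fixes τ (ε , i)
        τ-fixes = begin
          Rm (h ⁻¹) (h , proj₂ (to σ (ε , i)))  ≡⟨ cong (λ k → Rm (h ⁻¹) (h , k)) layer ⟩
          (h ∙ (h ⁻¹) , i)                      ≡⟨ cong (_, i) (inverseʳ h) ⟩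
          (ε , i)                               ∎

lemma4p2 : (G : FiniteGroup) → (m' : ℕ) → 1 ≤ m' →
  (T : Fin (suc m') → Fin (suc m') → FiniteGroup.Carrier G → Set) →
  let open FiniteGroup G
      open Cayley G (suc m') T
  in (∀ i → ¬ T i i ε) →
     (∀ i j t → T j i t ⇔ T i j (t ⁻¹)) →
     (∀ g → Generated G (λ x → ∃[ i ] ∃[ j ] T i j x) g) →
     (∀ (σ : Vertex ↔ Vertex) → IsAut σ → ∀ g → proj₂ (Inverse.to σ (g , zero)) ≡ zero) →
     (∀ (σ : Vertex ↔ Vertex) → IsAut σ → ∀ i →
        (Inverse.to σ (ε , zero) ≡ (ε , zero)) ⇔ (Inverse.to σ (ε , i) ≡ (ε , i))) →
     (∀ (σ : Vertex ↔ Vertex) → IsAut σ → ∀ i → Inverse.to σ (ε , i) ≡ (ε , i) →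
        ∀ v → Adj (ε , i) v → Inverse.to σ v ≡ v) →
     (∀ (σ : Vertex ↔ Vertex) → IsAut σ → ∃[ g ] (∀ v → Inverse.to σ v ≡ Rm g v))
     × (∀ g → Σ (Vertex ↔ Vertex) (λ σ → IsAut σ × (∀ v → Inverse.to σ v ≡ Rm g v)))
lemma4p2 G m' _ T _ T-inverse generates preserves-G₁ stab-ε stab-Γ =
  (λ σ σ-aut → layerPreserving⇒Rm σ σ-aut (preserves-G₁ σ σ-aut ε)) ,
  (λ g → Rm↔ g , Rm-isAut g , λ _ → refl)
  where
  open FiniteGroup G
  open CayleyAutomorphisms G (suc m') T

  stabilisers-coincide : StabilisersOfIdentityCoincide
  stabilisers-coincide σ σ-aut i j =
    Equivalence.to (stab-ε σ σ-aut j) ∘ Equivalence.from (stab-ε σ σ-aut i)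
  open Rigidity stabilisers-coincide stab-Γ
  open Connected (λ i j t → Equivalence.to (T-inverse j i t)) generates
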